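{- Let $A,B,C$ be nonzero integers with $\gcd(A,B,C)=1$, let $D$ be an integer, and let $X,Y,Z$ be positive integers. Let \[ \Sigma=\{(x,y,z)\in\mathbb{Z}^3: 0\le x\le X,\ 0\le y\le Y,\ 0\le z\le Z\},\qquad M=\#\{(x,y,z)\in\Sigma: Ax+By+Cz=D\}. \] Then, with $\alpha=\gcd(B,C)$, \[ M\le\Bigl(1+\Bigl\lfloor\frac X\alpha\Bigr\rfloor\Bigr)\Bigl(1+\Bigl\lfloor\frac{Y}{|C|/\alpha}\Bigr\rfloor\Bigr)\quad\text{and}\quad M\le\Bigl(1+\Bigl\lfloor\frac X\alpha\Bigr\rfloor\Bigr)\Bigl(1+\Bigl\lfloor\frac{Z}{|B|/\alpha}\Bigr\rfloor\Bigr). \] If moreover $M\ge\max\{X+Y+1,\,Y+Z+1,\,Z+X+1\}$, then \[ |A|\le\frac{(Y+1)(Z+1)}{M-\max\{Y,Z\}},\qquad |B|\le\frac{(X+1)(Z+1)}{M-\max\{X,Z\}},\qquad |C|\le\frac{(X+1)(Y+1)}{M-\max\{X,Y\}}. \] -}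

module Defs where

open import Data.Nat as ℕ using (ℕ; zero; suc)
open import Data.Nat.DivMod using (_/_)
open import Data.Integer as ℤ using (ℤ; +_)
open import Data.List using (List; length; filter; upTo; cartesianProduct)
open import Data.Product using (_×_; _,_)
open import Relation.Binary.PropositionalEquality using (_≡_)

-- floor division on ℕ; the divisor 0 case is a junk value (never used:
-- all divisors in the statement are nonzero).
_div_ : ℕ → ℕ → ℕ
m div zero = 0
m div (suc k) = m / suc k

box : ℕ → ℕ → ℕ → List (ℕ × (ℕ × ℕ))
box X Y Z = cartesianProduct (upTo (suc X)) (cartesianProduct (upTo (suc Y)) (upTo (suc Z)))

lin : ℤ → ℤ → ℤ → ℕ × (ℕ × ℕ) → ℤ
lin A B C (x , y , z) = A ℤ.* + x ℤ.+ B ℤ.* + y ℤ.+ C ℤ.* + z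

count : ℤ → ℤ → ℤ → ℤ → ℕ → ℕ → ℕ → ℕ
count A B C D X Y Z = length (filter (λ p → lin A B C p ℤ.≟ D) (box X Y Z))

module Submission where

-- Write α = gcd(B, C) and β = |C|/α. Two solutions with the same ⌊x/α⌋ and ⌊y/β⌋
-- coincide: α divides A(x − x′) and is coprime to A, so α ∣ x − x′ and x = x′; then
-- B(y − y′) = −C(z − z′) forces β ∣ y − y′, so y = y′, and C ≠ 0 gives z = z′. Hence the
-- cells (⌊x/α⌋, ⌊y/β⌋) separate the solutions, which is the first bound; the others come
-- from permuting the roles of the coordinates. For the bound on |C| take q = ⌊X/α⌋ and
-- s = ⌊Y/β⌋: M > X + Y forces q, s ≥ 1, and since α ≤ qα ≤ max{X,Y} and β ≤ sβ ≤ max{X,Y},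
-- |C|(M − max{X,Y}) ≤ αβ((q+1)(s+1) − max{X,Y}) ≤ (qα + 1)(sβ + 1) ≤ (X+1)(Y+1).

open import Defs
open import Data.Nat using (ℕ; suc; _≤_; _*_; _+_; _∸_; _⊔_)
open import Data.Nat.GCD using (gcd)
open import Data.Integer using (ℤ; ∣_∣; 0ℤ)
open import Data.Product using (_×_)
open import Relation.Binary.PropositionalEquality using (_≡_)
open import Relation.Nullary using (¬_)

import Algebra.Properties.CommutativeSemigroup as CommutativeSemigroup
open import Data.Fin as Fin using (Fin; toℕ; fromℕ<; combine)
open import Data.Fin.Properties using (toℕ-fromℕ<; injective⇒≤; combine-injective)
import Data.Integer as ℤ
open import Data.Integer using (+_)
import Data.Integer.Coprimality as ℤ
open import Data.Integer.Divisibility.Signed as Signed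
  using (∣ᵤ⇒∣; ∣⇒∣ᵤ; ∣m∣n⇒∣m+n; ∣m+n∣n⇒∣m; ∣m⇒∣m*n)
import Data.Integer.Properties as ℤ
import Data.Integer.Tactic.RingSolver as ℤ-Solver
open import Data.List using (List; []; _∷_; length; lookup; filter; upTo)
open import Data.List.Membership.Propositional using (_∈_)
open import Data.List.Membership.Propositional.Properties
  using (∈-lookup; ∈-filter⁻; ∈-cartesianProduct⁻; ∈-upTo⁻)
import Data.List.Relation.Unary.All as All
open import Data.List.Relation.Unary.AllPairs using (_∷_)
open import Data.List.Relation.Unary.Unique.Propositional using (Unique)
open import Data.List.Relation.Unary.Unique.Propositional.Properties
  using (filter⁺; cartesianProduct⁺; upTo⁺)
import Data.Nat as ℕ
open import Data.Nat using (zero; z≤n; s≤s; s≤s⁻¹)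
open import Data.Nat.Coprimality as Coprimality
  using (Coprime; coprime-divisor; coprime-/gcd; gcd≡1⇒coprime)
open import Data.Nat.DivMod
  using (_/_; _%_; /-monoˡ-≤; m≡m%n+[m/n]*n; %-remove-+ʳ; m/n*n≡m; m/n*n≤m; m*[n/m]≡n)
open import Data.Nat.Divisibility as ℕ using (0∣⇒≡0)
open import Data.Nat.GCD using (gcd[m,n]∣m; gcd[m,n]∣n; gcd[m,n]≢0; gcd-comm; gcd-assoc)
open import Data.Nat.Properties
import Data.Nat.Tactic.RingSolver as ℕ-Solver
open import Data.Product as Product using (_,_; proj₁; proj₂)
open import Data.Sum using (inj₁; inj₂)
open import Function using (id)
open import Relation.Binary.PropositionalEquality
  using (refl; sym; trans; cong; cong₂; subst; module ≡-Reasoning)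
open import Relation.Nullary using (contradiction)

open import Algebra.Properties.AbelianGroup ℤ.+-0-abelianGroup using (inverseˡ-unique)
open CommutativeSemigroup *-commutativeSemigroup using () renaming (xy∙z≈xz∙y to *-rightComm)
open CommutativeSemigroup ℤ.+-commutativeSemigroup using (xy∙z≈xz∙y; xy∙z≈yz∙x)

Unique⇒lookup-injective : ∀ {a} {A : Set a} {xs : List A} → Unique xs →
  ∀ {i j} → lookup xs i ≡ lookup xs j → i ≡ j
Unique⇒lookup-injective (_ ∷ _)  {Fin.zero}  {Fin.zero}  _  = refl
Unique⇒lookup-injective (x∉ ∷ _) {Fin.zero}  {Fin.suc j} eq = contradiction eq (All.lookup x∉ (∈-lookup j))
Unique⇒lookup-injective (x∉ ∷ _) {Fin.suc i} {Fin.zero}  eq = contradiction (sym eq) (All.lookup x∉ (∈-lookup i))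
Unique⇒lookup-injective (_ ∷ u)  {Fin.suc i} {Fin.suc j} eq = cong Fin.suc (Unique⇒lookup-injective u eq)

injectiveOn⇒length≤ : ∀ {a} {A : Set a} {xs : List A} {n} → Unique xs → (f : A → Fin n) →
  (∀ {x y} → x ∈ xs → y ∈ xs → f x ≡ f y → x ≡ y) → length xs ≤ n
injectiveOn⇒length≤ u f f-injective =
  injective⇒≤ (λ eq → Unique⇒lookup-injective u (f-injective (∈-lookup _) (∈-lookup _) eq))

clamp : ℕ → (k : ℕ) → Fin (suc k)
clamp n k = fromℕ< (s≤s (m⊓n≤n n k))

toℕ-clamp : ∀ {n k} → n ≤ k → toℕ (clamp n k) ≡ n
toℕ-clamp n≤k = trans (toℕ-fromℕ< _) (m≤n⇒m⊓n≡m n≤k)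

clamp-injective : ∀ {m n k} → m ≤ k → n ≤ k → clamp m k ≡ clamp n k → m ≡ n
clamp-injective m≤k n≤k eq = trans (sym (toℕ-clamp m≤k)) (trans (cong toℕ eq) (toℕ-clamp n≤k))

div≡/ : ∀ m n .{{_ : ℕ.NonZero n}} → m div n ≡ m / n
div≡/ m (suc n) = refl

div-monoˡ-≤ : ∀ {m n} d → m ≤ n → m div d ≤ n div d
div-monoˡ-≤ zero    _   = z≤n
div-monoˡ-≤ (suc d) m≤n = /-monoˡ-≤ (suc d) m≤n

m-div-n*n≤m : ∀ m n → m div n * n ≤ m
m-div-n*n≤m m zero    = z≤n
m-div-n*n≤m m (suc n) = m/n*n≤m m (suc n)

n*[m-div-n]≡m : ∀ {m n} → n ℕ.∣ m → n * (m div n) ≡ m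
n*[m-div-n]≡m {n = zero}  0∣m = sym (0∣⇒≡0 0∣m)
n*[m-div-n]≡m {n = suc n} n∣m = m*[n/m]≡n n∣m

∣+m-+n∣≡n∸m : ∀ {m n} → m ≤ n → ∣ + m ℤ.- + n ∣ ≡ n ∸ m
∣+m-+n∣≡n∸m {m} {n} m≤n = trans (cong ∣_∣ (ℤ.[+m]-[+n]≡m⊖n m n)) (ℤ.∣⊖∣-≤ m≤n)

d∣n∸m⇒n%d≡m%d : ∀ {m n} d .{{_ : ℕ.NonZero d}} → m ≤ n → d ℕ.∣ n ∸ m → n % d ≡ m % d
d∣n∸m⇒n%d≡m%d {m} {n} d m≤n d∣n∸m = begin
  n % d             ≡⟨ cong (_% d) (m+[n∸m]≡n m≤n) ⟨
  (m + (n ∸ m)) % d ≡⟨ %-remove-+ʳ m d∣n∸m ⟩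
  m % d             ∎
  where open ≡-Reasoning

d∣∣+m-+n∣⇒m%d≡n%d : ∀ {m n} d .{{_ : ℕ.NonZero d}} → d ℕ.∣ ∣ + m ℤ.- + n ∣ → m % d ≡ n % d
d∣∣+m-+n∣⇒m%d≡n%d {m} {n} d d∣ with ≤-total m n
... | inj₁ m≤n = sym (d∣n∸m⇒n%d≡m%d d m≤n (subst (d ℕ.∣_) (∣+m-+n∣≡n∸m m≤n) d∣))
... | inj₂ n≤m =
  d∣n∸m⇒n%d≡m%d d n≤m (subst (d ℕ.∣_) (trans (ℤ.∣i-j∣≡∣j-i∣ (+ m) (+ n)) (∣+m-+n∣≡n∸m n≤m)) d∣)

congruent-div-injective : ∀ d {m n} → d ℕ.∣ ∣ + m ℤ.- + n ∣ → m div d ≡ n div d → m ≡ n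
congruent-div-injective zero {m} {n} 0∣ _ =
  ℤ.+-injective (ℤ.i-j≡0⇒i≡j (+ m) (+ n) (ℤ.∣i∣≡0⇒i≡0 (0∣⇒≡0 0∣)))
congruent-div-injective d@(suc _) {m} {n} d∣ m/d≡n/d = begin
  m                 ≡⟨ m≡m%n+[m/n]*n m d ⟩
  m % d + m / d * d ≡⟨ cong₂ (λ r q → r + q * d) (d∣∣+m-+n∣⇒m%d≡n%d {m} {n} d d∣) m/d≡n/d ⟩
  n % d + n / d * d ≡⟨ m≡m%n+[m/n]*n n d ⟨
  n                 ∎
  where open ≡-Reasoning

m+n+m*n≤o+m*n*o : ∀ {m n o} → m ℕ.< o → n ℕ.< o → m + n + m * n ≤ o + m * n * o
m+n+m*n≤o+m*n*o {zero} _ n<o = +-mono-≤ (<⇒≤ n<o) z≤n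
m+n+m*n≤o+m*n*o {suc m} {n} {o} m<o _ = begin
  suc m + n + suc m * n                         ≤⟨ +-monoˡ-≤ (suc m * n) (+-monoʳ-≤ (suc m) n≤m*[m*n]) ⟩
  suc m + suc m * (suc m * n) + suc m * n       ≤⟨ n≤1+n _ ⟩
  suc (suc m + suc m * (suc m * n) + suc m * n) ≡⟨ ℕ-Solver.solve (m ∷ n ∷ []) ⟩
  suc (suc m) + suc m * n * suc (suc m)         ≤⟨ +-mono-≤ m<o (*-monoʳ-≤ (suc m * n) m<o) ⟩
  o + suc m * n * o                             ∎
  where
  open ≤-Reasoning
  n≤m*[m*n] : n ≤ suc m * (suc m * n)
  n≤m*[m*n] = ≤-trans (m≤n*m n (suc m)) (m≤n*m (suc m * n) (suc m))

[a+p]*[c+q]≤a*c*m+[1+p]*[1+q] : ∀ a c {p q m} .{{_ : ℕ.NonZero a}} .{{_ : ℕ.NonZero c}} →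
  a ≤ m → c ≤ m → p ≤ m → q ≤ m → (a + p) * (c + q) ≤ a * c * m + suc p * suc q
[a+p]*[c+q]≤a*c*m+[1+p]*[1+q] (suc a) (suc c) {p} {q} {m} a<m c<m p≤m q≤m = begin
  (suc a + p) * (suc c + q)
    ≡⟨ ℕ-Solver.solve (a ∷ c ∷ p ∷ q ∷ []) ⟩
  suc p * suc q + ((a + c + a * c) + (a * q + c * p))
    ≤⟨ +-monoʳ-≤ (suc p * suc q)
         (+-mono-≤ (m+n+m*n≤o+m*n*o a<m c<m) (+-mono-≤ (*-monoʳ-≤ a q≤m) (*-monoʳ-≤ c p≤m))) ⟩
  suc p * suc q + ((m + a * c * m) + (a * m + c * m))
    ≡⟨ ℕ-Solver.solve (a ∷ c ∷ p ∷ q ∷ m ∷ []) ⟩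
  suc a * suc c * m + suc p * suc q ∎
  where open ≤-Reasoning

coefficient-bound : ∀ a c q s {R₁ R₂ M} → q * a ≤ R₁ → s * c ≤ R₂ → 1 ≤ R₁ → 1 ≤ R₂ →
  suc (R₁ + R₂) ≤ M → M ≤ suc q * suc s → a * c * (M ∸ (R₁ ⊔ R₂)) ≤ suc R₁ * suc R₂
coefficient-bound zero c q s _ _ _ _ _ _ = z≤n
coefficient-bound a@(suc _) zero q s {R₁} {R₂} {M} _ _ _ _ _ _ =
  ≤-trans (≤-reflexive (cong (_* (M ∸ (R₁ ⊔ R₂))) (*-zeroʳ a))) z≤n
coefficient-bound (suc _) c@(suc _) zero s {R₁} {R₂} {M} _ s*c≤R₂ 1≤R₁ _ R₁+R₂<M M≤1+s =
  contradiction (begin-strict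
    M         ≤⟨ M≤1+s ⟩
    1 * suc s ≡⟨ *-identityˡ (suc s) ⟩
    suc s     ≤⟨ s≤s (≤-trans (m≤m*n s c) s*c≤R₂) ⟩
    suc R₂    ≤⟨ m<n+m R₂ 1≤R₁ ⟩
    R₁ + R₂   <⟨ R₁+R₂<M ⟩
    M         ∎) (<-irrefl refl)
  where open ≤-Reasoning
coefficient-bound a@(suc _) (suc _) q@(suc _) zero {R₁} {R₂} {M} q*a≤R₁ _ _ 1≤R₂ R₁+R₂<M M≤1+q =
  contradiction (begin-strict
    M         ≤⟨ M≤1+q ⟩
    suc q * 1 ≡⟨ *-identityʳ (suc q) ⟩
    suc q     ≤⟨ s≤s (≤-trans (m≤m*n q a) q*a≤R₁) ⟩
    suc R₁    ≤⟨ m<m+n R₁ 1≤R₂ ⟩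
    R₁ + R₂   <⟨ R₁+R₂<M ⟩
    M         ∎) (<-irrefl refl)
  where open ≤-Reasoning
coefficient-bound a@(suc _) c@(suc _) q@(suc _) s@(suc _) {R₁} {R₂} {M} q*a≤R₁ s*c≤R₂ _ _ _ M≤ = begin
  a * c * (M ∸ m)                     ≤⟨ *-monoʳ-≤ (a * c) (∸-monoˡ-≤ m M≤) ⟩
  a * c * (suc q * suc s ∸ m)         ≡⟨ *-distribˡ-∸ (a * c) (suc q * suc s) m ⟩
  a * c * (suc q * suc s) ∸ a * c * m ≤⟨ m≤n+o⇒m∸n≤o _ (a * c * m) expanded ⟩
  suc R₁ * suc R₂                     ∎
  where
  open ≤-Reasoning
  m = R₁ ⊔ R₂
  q*a≤m : q * a ≤ m
  q*a≤m = ≤-trans q*a≤R₁ (m≤m⊔n R₁ R₂)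
  s*c≤m : s * c ≤ m
  s*c≤m = ≤-trans s*c≤R₂ (m≤n⊔m R₁ R₂)
  regroup : ∀ a c q s → a * c * (suc q * suc s) ≡ (a + q * a) * (c + s * c)
  regroup = ℕ-Solver.solve-∀
  expanded : a * c * (suc q * suc s) ≤ a * c * m + suc R₁ * suc R₂
  expanded = begin
    a * c * (suc q * suc s)               ≡⟨ regroup a c q s ⟩
    (a + q * a) * (c + s * c)             ≤⟨ [a+p]*[c+q]≤a*c*m+[1+p]*[1+q] a c
                                               (≤-trans (m≤m+n a _) q*a≤m) (≤-trans (m≤m+n c _) s*c≤m)
                                               q*a≤m s*c≤m ⟩
    a * c * m + suc (q * a) * suc (s * c) ≤⟨ +-monoʳ-≤ (a * c * m) (*-mono-≤ (s≤s q*a≤R₁) (s≤s s*c≤R₂)) ⟩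
    a * c * m + suc R₁ * suc R₂           ∎

coefficient-bound-div : ∀ {K} a {R₁ R₂ M} → a ℕ.∣ K → 1 ≤ R₁ → 1 ≤ R₂ → suc (R₁ + R₂) ≤ M →
  M ≤ suc (R₁ div a) * suc (R₂ div (K div a)) → K * (M ∸ (R₁ ⊔ R₂)) ≤ suc R₁ * suc R₂
coefficient-bound-div {K} a {R₁} {R₂} {M} a∣K 1≤R₁ 1≤R₂ R₁+R₂<M M≤ =
  subst (λ k → k * (M ∸ (R₁ ⊔ R₂)) ≤ suc R₁ * suc R₂) (n*[m-div-n]≡m a∣K)
    (coefficient-bound a (K div a) (R₁ div a) (R₂ div (K div a))
      (m-div-n*n≤m R₁ a) (m-div-n*n≤m R₂ (K div a)) 1≤R₁ 1≤R₂ R₁+R₂<M M≤)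

gcd-rotate : ∀ a b c → gcd b (gcd c a) ≡ gcd a (gcd b c)
gcd-rotate a b c = trans (sym (gcd-assoc b c a)) (gcd-comm (gcd b c) a)

common-divisor-∣ : ∀ {α U V W x y z} → α ℕ.∣ ∣ V ∣ → α ℕ.∣ ∣ W ∣ → Coprime α ∣ U ∣ →
  U ℤ.* x ℤ.+ (V ℤ.* y ℤ.+ W ℤ.* z) ≡ 0ℤ → α ℕ.∣ ∣ x ∣
common-divisor-∣ {α} {U} {V} {W} {x} {y} {z} α∣V α∣W α⊥U eq =
  ℤ.coprime-divisor (+ α) U x α⊥U (∣⇒∣ᵤ (∣m+n∣n⇒∣m {m = U ℤ.* x} α∣sum α∣Vy+Wz))
  where
  α∣sum : + α Signed.∣ U ℤ.* x ℤ.+ (V ℤ.* y ℤ.+ W ℤ.* z)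
  α∣sum = subst (+ α Signed.∣_) (sym eq) (∣ᵤ⇒∣ (ℕ._∣0 α))
  α∣Vy+Wz : + α Signed.∣ V ℤ.* y ℤ.+ W ℤ.* z
  α∣Vy+Wz = ∣m∣n⇒∣m+n (∣m⇒∣m*n y (∣ᵤ⇒∣ {i = V} α∣V)) (∣m⇒∣m*n z (∣ᵤ⇒∣ {i = W} α∣W))

reduced-coefficient-∣ : ∀ {V W y z} → ¬ W ≡ 0ℤ → V ℤ.* y ℤ.+ W ℤ.* z ≡ 0ℤ →
  ∣ W ∣ div (gcd ∣ V ∣ ∣ W ∣) ℕ.∣ ∣ y ∣
reduced-coefficient-∣ {V} {W} {y} {z} W≢0 eq =
  subst (ℕ._∣ ∣ y ∣) (sym (div≡/ ∣ W ∣ α))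
    (coprime-divisor (Coprimality.sym (coprime-/gcd ∣ V ∣ ∣ W ∣)) (ℕ.divides ∣ z ∣ v∣y∣≡∣z∣w))
  where
  open ≡-Reasoning
  α = gcd ∣ V ∣ ∣ W ∣
  instance
    ∣W∣≢0 : ℕ.NonZero ∣ W ∣
    ∣W∣≢0 = ℤ.≢-nonZero W≢0
    α≢0 : ℕ.NonZero α
    α≢0 = ℕ.≢-nonZero (gcd[m,n]≢0 ∣ V ∣ ∣ W ∣ (inj₂ (ℕ.≢-nonZero⁻¹ ∣ W ∣)))
  v = ∣ V ∣ / α
  w = ∣ W ∣ / α
  ∣V∣∣y∣≡∣W∣∣z∣ : ∣ V ∣ * ∣ y ∣ ≡ ∣ W ∣ * ∣ z ∣
  ∣V∣∣y∣≡∣W∣∣z∣ = begin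
    ∣ V ∣ * ∣ y ∣     ≡⟨ ℤ.abs-* V y ⟨
    ∣ V ℤ.* y ∣       ≡⟨ cong ∣_∣ (inverseˡ-unique (V ℤ.* y) (W ℤ.* z) eq) ⟩
    ∣ ℤ.- (W ℤ.* z) ∣ ≡⟨ ℤ.∣-i∣≡∣i∣ (W ℤ.* z) ⟩
    ∣ W ℤ.* z ∣       ≡⟨ ℤ.abs-* W z ⟩
    ∣ W ∣ * ∣ z ∣     ∎
  v∣y∣≡∣z∣w : v * ∣ y ∣ ≡ ∣ z ∣ * w
  v∣y∣≡∣z∣w = trans (*-cancelʳ-≡ _ _ α (begin
    v * ∣ y ∣ * α     ≡⟨ *-rightComm v ∣ y ∣ α ⟩
    v * α * ∣ y ∣     ≡⟨ cong (_* ∣ y ∣) (m/n*n≡m (gcd[m,n]∣m ∣ V ∣ ∣ W ∣)) ⟩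
    ∣ V ∣ * ∣ y ∣     ≡⟨ ∣V∣∣y∣≡∣W∣∣z∣ ⟩
    ∣ W ∣ * ∣ z ∣     ≡⟨ cong (_* ∣ z ∣) (m/n*n≡m (gcd[m,n]∣n ∣ V ∣ ∣ W ∣)) ⟨
    w * α * ∣ z ∣     ≡⟨ *-rightComm w α ∣ z ∣ ⟩
    w * ∣ z ∣ * α     ∎)) (*-comm w ∣ z ∣)

Triple : Set
Triple = ℕ × ℕ × ℕ

lin-difference : ∀ U V W a b c a′ b′ c′ →
  (U ℤ.* a ℤ.+ V ℤ.* b ℤ.+ W ℤ.* c) ℤ.- (U ℤ.* a′ ℤ.+ V ℤ.* b′ ℤ.+ W ℤ.* c′)
    ≡ U ℤ.* (a ℤ.- a′) ℤ.+ (V ℤ.* (b ℤ.- b′) ℤ.+ W ℤ.* (c ℤ.- c′))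
lin-difference = ℤ-Solver.solve-∀

m≡n⇒k*[+m-+n]≡0 : ∀ K {m n} → m ≡ n → K ℤ.* (+ m ℤ.- + n) ≡ 0ℤ
m≡n⇒k*[+m-+n]≡0 K {m} refl = trans (cong (K ℤ.*_) (ℤ.+-inverseʳ (+ m))) (ℤ.*-zeroʳ K)

k*[+m-+n]≡0⇒m≡n : ∀ {K m n} → ¬ K ≡ 0ℤ → K ℤ.* (+ m ℤ.- + n) ≡ 0ℤ → m ≡ n
k*[+m-+n]≡0⇒m≡n {K} {m} {n} K≢0 eq with ℤ.i*j≡0⇒i≡0∨j≡0 K eq
... | inj₁ K≡0   = contradiction K≡0 K≢0
... | inj₂ m-n≡0 = ℤ.+-injective (ℤ.i-j≡0⇒i≡j (+ m) (+ n) m-n≡0)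

x≡0∧x+y≡0⇒y≡0 : ∀ {x y} → x ≡ 0ℤ → x ℤ.+ y ≡ 0ℤ → y ≡ 0ℤ
x≡0∧x+y≡0⇒y≡0 {x} {y} x≡0 x+y≡0 =
  trans (sym (ℤ.+-identityˡ y)) (trans (cong (ℤ._+ y) (sym x≡0)) x+y≡0)

solution-determined-by-floors : ∀ {U V W u v w u′ v′ w′} →
  ¬ W ≡ 0ℤ → Coprime (gcd ∣ V ∣ ∣ W ∣) ∣ U ∣ →
  lin U V W (u , v , w) ≡ lin U V W (u′ , v′ , w′) →
  u div (gcd ∣ V ∣ ∣ W ∣) ≡ u′ div (gcd ∣ V ∣ ∣ W ∣) →
  v div (∣ W ∣ div (gcd ∣ V ∣ ∣ W ∣)) ≡ v′ div (∣ W ∣ div (gcd ∣ V ∣ ∣ W ∣)) →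
  (u , v , w) ≡ (u′ , v′ , w′)
solution-determined-by-floors {U} {V} {W} {u} {v} {w} {u′} {v′} {w′} W≢0 α⊥U same-value u-floors v-floors =
  cong₂ _,_ u≡u′ (cong₂ _,_ v≡v′ w≡w′)
  where
  α = gcd ∣ V ∣ ∣ W ∣
  UΔu+VΔv+WΔw≡0 : U ℤ.* (+ u ℤ.- + u′) ℤ.+ (V ℤ.* (+ v ℤ.- + v′) ℤ.+ W ℤ.* (+ w ℤ.- + w′)) ≡ 0ℤ
  UΔu+VΔv+WΔw≡0 = trans (sym (lin-difference U V W (+ u) (+ v) (+ w) (+ u′) (+ v′) (+ w′)))
                         (ℤ.i≡j⇒i-j≡0 same-value)
  u≡u′ : u ≡ u′
  u≡u′ = congruent-div-injective α
    (common-divisor-∣ {U = U} {V} {W} (gcd[m,n]∣m ∣ V ∣ ∣ W ∣) (gcd[m,n]∣n ∣ V ∣ ∣ W ∣) α⊥U UΔu+VΔv+WΔw≡0)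
    u-floors
  VΔv+WΔw≡0 : V ℤ.* (+ v ℤ.- + v′) ℤ.+ W ℤ.* (+ w ℤ.- + w′) ≡ 0ℤ
  VΔv+WΔw≡0 = x≡0∧x+y≡0⇒y≡0 (m≡n⇒k*[+m-+n]≡0 U u≡u′) UΔu+VΔv+WΔw≡0
  v≡v′ : v ≡ v′
  v≡v′ = congruent-div-injective (∣ W ∣ div α) (reduced-coefficient-∣ {V} W≢0 VΔv+WΔw≡0) v-floors
  w≡w′ : w ≡ w′
  w≡w′ = k*[+m-+n]≡0⇒m≡n W≢0 (x≡0∧x+y≡0⇒y≡0 (m≡n⇒k*[+m-+n]≡0 V v≡v′) VΔv+WΔw≡0)

∈-box⁻ : ∀ {X Y Z t} → t ∈ box X Y Z → proj₁ t ≤ X × proj₁ (proj₂ t) ≤ Y × proj₂ (proj₂ t) ≤ Z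
∈-box⁻ {X} {Y} {Z} t∈
  with x∈ , yz∈ ← ∈-cartesianProduct⁻ (upTo (suc X)) _ t∈
  with y∈ , z∈ ← ∈-cartesianProduct⁻ (upTo (suc Y)) (upTo (suc Z)) yz∈
  = s≤s⁻¹ (∈-upTo⁻ x∈) , s≤s⁻¹ (∈-upTo⁻ y∈) , s≤s⁻¹ (∈-upTo⁻ z∈)

box-unique : ∀ X Y Z → Unique (box X Y Z)
box-unique X Y Z = cartesianProduct⁺ (upTo⁺ (suc X)) (cartesianProduct⁺ (upTo⁺ (suc Y)) (upTo⁺ (suc Z)))

count≤ : ∀ A B C D X Y Z U V W {Ū V̄} (σ : Triple → Triple) →
  ¬ W ≡ 0ℤ → gcd ∣ U ∣ (gcd ∣ V ∣ ∣ W ∣) ≡ 1 →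
  (∀ {t t′} → σ t ≡ σ t′ → t ≡ t′) →
  (∀ t → lin A B C t ≡ lin U V W (σ t)) →
  (∀ {t} → proj₁ t ≤ X × proj₁ (proj₂ t) ≤ Y × proj₂ (proj₂ t) ≤ Z →
           proj₁ (σ t) ≤ Ū × proj₁ (proj₂ (σ t)) ≤ V̄) →
  count A B C D X Y Z ≤ suc (Ū div (gcd ∣ V ∣ ∣ W ∣)) * suc (V̄ div (∣ W ∣ div (gcd ∣ V ∣ ∣ W ∣)))
count≤ A B C D X Y Z U V W {Ū} {V̄} σ W≢0 gcd≡1 σ-injective lin≡ bounded =
  injectiveOn⇒length≤ (filter⁺ solves? (box-unique X Y Z)) cell cell-injective
  where
  solves? = λ t → lin A B C t ℤ.≟ D
  α = gcd ∣ V ∣ ∣ W ∣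
  β = ∣ W ∣ div α
  cell : Triple → Fin (suc (Ū div α) * suc (V̄ div β))
  cell t = combine (clamp (proj₁ (σ t) div α) (Ū div α)) (clamp (proj₁ (proj₂ (σ t)) div β) (V̄ div β))
  cell-injective : ∀ {t t′} → t ∈ filter solves? (box X Y Z) → t′ ∈ filter solves? (box X Y Z) →
    cell t ≡ cell t′ → t ≡ t′
  cell-injective {t} {t′} t∈ t′∈ same-cell
    with t∈box , t-solves ← ∈-filter⁻ solves? {xs = box X Y Z} t∈
    with t′∈box , t′-solves ← ∈-filter⁻ solves? {xs = box X Y Z} t′∈
    with u≤ , v≤ ← bounded (∈-box⁻ {X} {Y} {Z} t∈box)
    with u′≤ , v′≤ ← bounded (∈-box⁻ {X} {Y} {Z} t′∈box)
    with same-u-cell , same-v-cell ← combine-injective _ _ _ _ same-cell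
    = σ-injective (solution-determined-by-floors {U} {V} {W} W≢0 (Coprimality.sym (gcd≡1⇒coprime gcd≡1))
        (trans (sym (lin≡ t)) (trans t-solves (trans (sym t′-solves) (lin≡ t′))))
        (clamp-injective (div-monoˡ-≤ α u≤) (div-monoˡ-≤ α u′≤) same-u-cell)
        (clamp-injective (div-monoˡ-≤ β v≤) (div-monoˡ-≤ β v′≤) same-v-cell))

swap₂₃ : Triple → Triple
swap₂₃ (x , y , z) = x , z , y

swap₂₃-injective : ∀ {t t′} → swap₂₃ t ≡ swap₂₃ t′ → t ≡ t′
swap₂₃-injective {_ , _ , _} {_ , _ , _} refl = refl

lin-swap₂₃ : ∀ A B C t → lin A B C t ≡ lin A C B (swap₂₃ t)
lin-swap₂₃ A B C (x , y , z) = xy∙z≈xz∙y (A ℤ.* + x) (B ℤ.* + y) (C ℤ.* + z)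

rotate : Triple → Triple
rotate (x , y , z) = y , z , x

rotate-injective : ∀ {t t′} → rotate t ≡ rotate t′ → t ≡ t′
rotate-injective {_ , _ , _} {_ , _ , _} refl = refl

lin-rotate : ∀ A B C t → lin A B C t ≡ lin B C A (rotate t)
lin-rotate A B C (x , y , z) = xy∙z≈yz∙x (A ℤ.* + x) (B ℤ.* + y) (C ℤ.* + z)

lemma14p5 : (A B C D : ℤ) (X Y Z : ℕ) →
    ¬ A ≡ 0ℤ → ¬ B ≡ 0ℤ → ¬ C ≡ 0ℤ →
    gcd ∣ A ∣ (gcd ∣ B ∣ ∣ C ∣) ≡ 1 →
    1 ≤ X → 1 ≤ Y → 1 ≤ Z →
    let M = count A B C D X Y Z
        α = gcd ∣ B ∣ ∣ C ∣
    in (M ≤ suc (X div α) * suc (Y div (∣ C ∣ div α))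
        × M ≤ suc (X div α) * suc (Z div (∣ B ∣ div α)))
     × (suc (X + Y) ≤ M → suc (Y + Z) ≤ M → suc (Z + X) ≤ M →
          ∣ A ∣ * (M ∸ (Y ⊔ Z)) ≤ suc Y * suc Z
        × ∣ B ∣ * (M ∸ (X ⊔ Z)) ≤ suc X * suc Z
        × ∣ C ∣ * (M ∸ (X ⊔ Y)) ≤ suc X * suc Y)
lemma14p5 A B C D X Y Z A≢0 B≢0 C≢0 gcd≡1 1≤X 1≤Y 1≤Z =
    (M≤xy-cells , M≤xz-cells)
  , λ X+Y<M Y+Z<M Z+X<M →
      coefficient-bound-div γ (gcd[m,n]∣n ∣ C ∣ ∣ A ∣) 1≤Y 1≤Z Y+Z<M M≤yz-cells
    , coefficient-bound-div α (gcd[m,n]∣m ∣ B ∣ ∣ C ∣) 1≤X 1≤Z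
        (subst (λ n → suc n ≤ M) (+-comm Z X) Z+X<M) M≤xz-cells
    , coefficient-bound-div α (gcd[m,n]∣n ∣ B ∣ ∣ C ∣) 1≤X 1≤Y X+Y<M M≤xy-cells
  where
  M = count A B C D X Y Z
  α = gcd ∣ B ∣ ∣ C ∣
  γ = gcd ∣ C ∣ ∣ A ∣
  M≤xy-cells : M ≤ suc (X div α) * suc (Y div (∣ C ∣ div α))
  M≤xy-cells = count≤ A B C D X Y Z A B C id C≢0 gcd≡1 id (λ _ → refl) (Product.map₂ proj₁)
  M≤xz-cells : M ≤ suc (X div α) * suc (Z div (∣ B ∣ div α))
  M≤xz-cells = subst (λ g → M ≤ suc (X div g) * suc (Z div (∣ B ∣ div g))) (gcd-comm ∣ C ∣ ∣ B ∣)
    (count≤ A B C D X Y Z A C B swap₂₃ B≢0 (trans (cong (gcd ∣ A ∣) (gcd-comm ∣ C ∣ ∣ B ∣)) gcd≡1)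
      swap₂₃-injective (lin-swap₂₃ A B C) (Product.map₂ proj₂))
  M≤yz-cells : M ≤ suc (Y div γ) * suc (Z div (∣ A ∣ div γ))
  M≤yz-cells = count≤ A B C D X Y Z B C A rotate A≢0 (trans (gcd-rotate (∣ A ∣) (∣ B ∣) (∣ C ∣)) gcd≡1)
    rotate-injective (lin-rotate A B C) proj₂
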